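{- For every instance of the multiprocessor power-down scheduling problem (defined in the context) that admits a feasible schedule, there exists an optimal schedule (one of minimum energy) that fulfills the stair-property: for every time slot $t \in T$ and every processor $k \in [m]$, if processor $k$ is busy at $t$, then every processor $k' \le k$ is busy at $t$ (equivalently, if $k$ is idle at $t$ then every $k' \ge k$ is idle at $t$).
   Context: Problem: there are $m \ge 1$ processors numbered $1,\dots,m$ and a set $J$ of $n$ jobs; each job $j$ has integer release time $r_j$, integer deadline $d_j$ and integer processing volume $p_j$. The earliest release time is $0$, the latest deadline is $d$, and the time slots are $T = \{0,\dots,d\}$; the execution interval of $j$ is $E_j = \{t \in T : r_j \le t \le d_j\}$. A (feasible) schedule assigns to each processor and each time slot at most one job, such that each job $j$ is assigned to exactly $p_j$ distinct time slots, all in $E_j$, and no job is assigned to two processors in the same slot (preemption and migration at integer times are allowed). A processor is busy at $t$ if some job is assigned to it at $t$, and idle otherwise. Each processor is in the on-state or off-state in each time slot; it can only be busy when on; all processors start in the off-state. The energy of a schedule is, summed over processors, the number of time slots the processor is on plus $q$ times the number of times it is turned on (i.e.\ $q$ per maximal interval of on-slots), where $q \ge 0$ is a fixed constant of the instance. An optimal schedule is a feasible schedule (together with on/off states consistent with it) of minimum energy.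
   Formalization: The switch-on constant q ranges over the nonnegative rationals. -}

module Defs where

open import Data.Nat as ℕ using (ℕ; zero; suc; _⊔_)
open import Data.Fin as Fin using (Fin; toℕ)
open import Data.Bool using (Bool; true; false; _∨_; _∧_; not; if_then_else_)
open import Data.Maybe using (Maybe; just; nothing; is-just)
open import Data.Integer using (+_)
open import Data.Rational as ℚ using (ℚ; _/_)
open import Data.Product using (Σ; _×_)
open import Relation.Binary.PropositionalEquality using (_≡_)
open import Relation.Nullary.Decidable using (⌊_⌋)

sumFin : ∀ {k} → (Fin k → ℕ) → ℕ
sumFin {zero}  f = 0
sumFin {suc k} f = f Fin.zero ℕ.+ sumFin (λ i → f (Fin.suc i))

anyFin : ∀ {k} → (Fin k → Bool) → Bool
anyFin {zero}  f = false
anyFin {suc k} f = f Fin.zero ∨ anyFin (λ i → f (Fin.suc i))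

countFin : ∀ {k} → (Fin k → Bool) → ℕ
countFin f = sumFin (λ i → if f i then 1 else 0)

maxFin : ∀ {k} → (Fin k → ℕ) → ℕ
maxFin {zero}  f = 0
maxFin {suc k} f = f Fin.zero ⊔ maxFin (λ i → f (Fin.suc i))

-- An instance: m processors, n jobs with release times r, deadlines dl,
-- processing volumes p (all over Fin n), and switch-on cost q.
module Instance (m n : ℕ) (r dl p : Fin n → ℕ) where

  horizon : ℕ
  horizon = maxFin dl

  Slot : Set
  Slot = Fin (suc horizon)

  Schedule : Set
  Schedule = Fin m → Slot → Maybe (Fin n)

  Busy : Schedule → Fin m → Slot → Set
  Busy S k t = is-just (S k t) ≡ true

  runsOn : Schedule → Fin n → Fin m → Slot → Bool
  runsOn S j k t with S k t
  ... | nothing = false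
  ... | just j' = ⌊ j' Fin.≟ j ⌋

  assignedAt : Schedule → Fin n → Slot → Bool
  assignedAt S j t = anyFin (λ k → runsOn S j k t)

  record Feasible (S : Schedule) : Set where
    field
      volume    : ∀ j → countFin (assignedAt S j) ≡ p j
      window    : ∀ k t j → S k t ≡ just j → r j ℕ.≤ toℕ t × toℕ t ℕ.≤ dl j
      noParallel : ∀ k k' t j → S k t ≡ just j → S k' t ≡ just j → k ≡ k'

  States : Set
  States = Fin m → Slot → Bool

  Consistent : Schedule → States → Set
  Consistent S on = ∀ k t → Busy S k t → on k t ≡ true

  -- processor k is turned on at slot t (all processors start off)
  turnedOn : States → Fin m → Slot → Bool
  turnedOn on k Fin.zero    = on k Fin.zero
  turnedOn on k (Fin.suc t) = on k (Fin.suc t) ∧ not (on k (Fin.inject₁ t))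

  onSlots : States → ℕ
  onSlots on = sumFin (λ k → countFin (on k))

  switchOns : States → ℕ
  switchOns on = sumFin (λ k → countFin (turnedOn on k))

  energy : ℚ → States → ℚ
  energy q on = (+ onSlots on / 1) ℚ.+ q ℚ.* (+ switchOns on / 1)

  Optimal : ℚ → Schedule → States → Set
  Optimal q S on = Feasible S × Consistent S on
    × (∀ (S' : Schedule) (on' : States) → Feasible S' → Consistent S' on'
         → energy q on ℚ.≤ energy q on')

  Stair : Schedule → Set
  Stair S = ∀ (t : Slot) (k k' : Fin m) → k' Fin.≤ k → Busy S k t → Busy S k' t

-- There are finitely many schedules and on/off states, so an energy-minimal
-- feasible pair (S, on) exists. Compact it slot by slot: the jobs running at t are moved,
-- in order, to processors 1, 2, ..., and exactly the c_t lowest processors are switched on,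
-- where c_t is the number of processors on at t in the original. The same jobs run in every
-- slot, so the result is feasible; it is consistent because at most c_t processors were busy;
-- it has the stair property by construction. The on-slots are unchanged, and at least
-- c_{t+1} - c_t processors must have been switched on at t + 1 originally, which is exactly
-- the number switched on after compaction; as q ≥ 0 the energy does not increase.
module Submission where

open import Defs
open import Data.Nat using (ℕ; zero; suc; _+_; _∸_; _≤_; _<_; _<ᵇ_; z≤n; s≤s)
import Data.Nat.Properties as ℕP
open import Algebra.Properties.CommutativeMonoid.Sum ℕP.+-0-commutativeMonoid using (sum; ∑-comm)
open import Data.Fin as Fin using (Fin; zero; suc; toℕ)
open import Data.Fin.Properties using (all?; suc-injective; toℕ-fromℕ<; toℕ-injective)
open import Data.Bool using (Bool; true; false; _∧_; not; if_then_else_)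
import Data.Bool.Properties as BoolP
open import Data.Maybe using (Maybe; just; nothing; is-just)
import Data.Maybe.Properties as MaybeP
open import Data.List using (List; []; _∷_; length; map; cartesianProduct; allFin; filter)
open import Data.List.Membership.Propositional using (_∈_)
open import Data.List.Membership.Propositional.Properties
  using (∈-map⁺; ∈-cartesianProduct⁺; ∈-allFin; ∈-filter⁺)
open import Data.List.Relation.Unary.Any using (here; there)
import Data.List.Relation.Unary.All as All
open import Data.List.Relation.Unary.All.Properties using (all-filter)
import Data.List.Extrema
import Data.Vec.Functional as Vector
open import Data.Vec.Functional.Relation.Binary.Pointwise using (Pointwise)
import Data.Product.Relation.Binary.Pointwise.NonDependent as ×
import Data.Integer as ℤ
import Data.Integer.Properties as ℤP
import Data.Rational
open import Data.Rational as ℚ using (ℚ; 0ℚ; _/_; mkℚ)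
import Data.Rational.Properties as ℚP
import Data.Nat.Coprimality as Coprime
open import Data.Product using (Σ; ∃-syntax; _×_; _,_; proj₁; proj₂)
open import Relation.Binary.Bundles using (DecTotalOrder)
open import Data.Sum using (_⊎_)
open import Function using (_∘_; _∘₂_; _⇔_; mk⇔; Equivalence)
import Function.Properties.Equivalence as ⇔
open import Relation.Nullary using (Dec; yes; no; contradiction)
open import Relation.Nullary.Decidable using (_×-dec_; _→-dec_; map′)
open import Relation.Binary.PropositionalEquality

sumFin≡sum : ∀ {k} (f : Fin k → ℕ) → sumFin f ≡ sum f
sumFin≡sum {zero}  f = refl
sumFin≡sum {suc k} f = cong (f zero +_) (sumFin≡sum (f ∘ suc))

sumFin-cong : ∀ {k} {f g : Fin k → ℕ} → (∀ i → f i ≡ g i) → sumFin f ≡ sumFin g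
sumFin-cong {zero}  e = refl
sumFin-cong {suc k} e = cong₂ _+_ (e zero) (sumFin-cong (e ∘ suc))

sumFin-mono-≤ : ∀ {k} {f g : Fin k → ℕ} → (∀ i → f i ≤ g i) → sumFin f ≤ sumFin g
sumFin-mono-≤ {zero}  e = z≤n
sumFin-mono-≤ {suc k} e = ℕP.+-mono-≤ (e zero) (sumFin-mono-≤ (e ∘ suc))

sumFin-comm : ∀ {a b} (f : Fin a → Fin b → ℕ) →
  sumFin (λ i → sumFin (f i)) ≡ sumFin (λ j → sumFin (λ i → f i j))
sumFin-comm f = begin
  sumFin (λ i → sumFin (f i))          ≡⟨ sumFin-cong (λ i → sumFin≡sum (f i)) ⟩
  sumFin (λ i → sum (f i))             ≡⟨ sumFin≡sum (λ i → sum (f i)) ⟩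
  sum (λ i → sum (f i))                ≡⟨ ∑-comm f ⟩
  sum (λ j → sum (λ i → f i j))        ≡⟨ sumFin≡sum (λ j → sum (λ i → f i j)) ⟨
  sumFin (λ j → sum (λ i → f i j))     ≡⟨ sumFin-cong (λ j → sumFin≡sum (λ i → f i j)) ⟨
  sumFin (λ j → sumFin (λ i → f i j))  ∎
  where open ≡-Reasoning

countFin≤ : ∀ {k} (f : Fin k → Bool) → countFin f ≤ k
countFin≤ {zero}  f = z≤n
countFin≤ {suc k} f with f zero
... | true  = s≤s (countFin≤ (f ∘ suc))
... | false = ℕP.m≤n⇒m≤1+n (countFin≤ (f ∘ suc))

countFin-mono : ∀ {k} {f g : Fin k → Bool} → (∀ i → f i ≡ true → g i ≡ true) → countFin f ≤ countFin g
countFin-mono {f = f} {g} f⇒g = sumFin-mono-≤ indicator-mono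
  where
  indicator-mono : ∀ i → (if f i then 1 else 0) ≤ (if g i then 1 else 0)
  indicator-mono i with f i | f⇒g i
  ... | false | _   = z≤n
  ... | true  | f⇒gᵢ rewrite f⇒gᵢ refl = ℕP.≤-refl

countFin-cong : ∀ {k} {f g : Fin k → Bool} → (∀ i → f i ≡ true ⇔ g i ≡ true) → countFin f ≡ countFin g
countFin-cong f⇔g =
  ℕP.≤-antisym (countFin-mono (Equivalence.to ∘ f⇔g)) (countFin-mono (Equivalence.from ∘ f⇔g))

countFin-false : ∀ {k} → countFin {k} (λ _ → false) ≡ 0
countFin-false {zero}  = refl
countFin-false {suc k} = countFin-false {k}

countFin-<ᵇ : ∀ {k} c → c ≤ k → countFin {k} (λ i → toℕ i <ᵇ c) ≡ c
countFin-<ᵇ {k}     zero    _         = countFin-false {k}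
countFin-<ᵇ {suc k} (suc c) (s≤s c≤k) = cong suc (countFin-<ᵇ c c≤k)

countFin-<ᵇ-∸ : ∀ {k} c c′ → c ≤ k →
  countFin {k} (λ i → (toℕ i <ᵇ c) ∧ not (toℕ i <ᵇ c′)) ≡ c ∸ c′
countFin-<ᵇ-∸ {k}     zero    c′       _         = trans (countFin-false {k}) (sym (ℕP.0∸n≡0 c′))
countFin-<ᵇ-∸ {suc k} (suc c) zero     (s≤s c≤k) = cong suc (countFin-<ᵇ-∸ c zero c≤k)
countFin-<ᵇ-∸ {suc k} (suc c) (suc c′) (s≤s c≤k) = countFin-<ᵇ-∸ c c′ c≤k

countFin-∸-≤ : ∀ {k} (f g : Fin k → Bool) → countFin f ∸ countFin g ≤ countFin (λ i → f i ∧ not (g i))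
countFin-∸-≤ f g = ℕP.m≤n+o⇒m∸n≤o (countFin f) (countFin g) (split f g)
  where
  split : ∀ {k} (f g : Fin k → Bool) → countFin f ≤ countFin g + countFin (λ i → f i ∧ not (g i))
  split {zero}  f g = z≤n
  split {suc k} f g with f zero | g zero
  ... | true  | true  = s≤s (split (f ∘ suc) (g ∘ suc))
  ... | true  | false = subst (suc (countFin (f ∘ suc)) ≤_)
      (sym (ℕP.+-suc (countFin (g ∘ suc)) (countFin (λ i → f (suc i) ∧ not (g (suc i))))))
      (s≤s (split (f ∘ suc) (g ∘ suc)))
  ... | false | true  = ℕP.m≤n⇒m≤1+n (split (f ∘ suc) (g ∘ suc))
  ... | false | false = split (f ∘ suc) (g ∘ suc)

anyFin-true⇔ : ∀ {k} (f : Fin k → Bool) → anyFin f ≡ true ⇔ (∃[ i ] f i ≡ true)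
anyFin-true⇔ f = mk⇔ (to f) (λ (i , fᵢ) → from f i fᵢ)
  where
  to : ∀ {k} (f : Fin k → Bool) → anyFin f ≡ true → ∃[ i ] f i ≡ true
  to {suc k} f any with f zero in f₀
  ... | true  = zero , f₀
  ... | false = let i , fᵢ = to (f ∘ suc) any in suc i , fᵢ
  from : ∀ {k} (f : Fin k → Bool) i → f i ≡ true → anyFin f ≡ true
  from f zero    f₀ rewrite f₀ = refl
  from f (suc i) fᵢ with f zero
  ... | true  = refl
  ... | false = from (f ∘ suc) i fᵢ

module _ {A : Set} where

  nth : List A → ℕ → Maybe A
  nth []       _       = nothing
  nth (x ∷ xs) zero    = just x
  nth (x ∷ xs) (suc a) = nth xs a

  nth-is-just⇔< : ∀ xs a → is-just (nth xs a) ≡ true ⇔ a < length xs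
  nth-is-just⇔< xs a = mk⇔ (to xs a) (from xs a)
    where
    to : ∀ xs a → is-just (nth xs a) ≡ true → a < length xs
    to (x ∷ xs) zero    _ = s≤s z≤n
    to (x ∷ xs) (suc a) p = s≤s (to xs a p)
    from : ∀ xs a → a < length xs → is-just (nth xs a) ≡ true
    from (x ∷ xs) zero    _         = refl
    from (x ∷ xs) (suc a) (s≤s a<n) = from xs a a<n

  nth-just⇒< : ∀ xs a {x} → nth xs a ≡ just x → a < length xs
  nth-just⇒< xs a eq = Equivalence.to (nth-is-just⇔< xs a) (cong is-just eq)

  justs : ∀ {k} → (Fin k → Maybe A) → List A
  justs {zero}  g = []
  justs {suc k} g with g zero
  ... | nothing = justs (g ∘ suc)
  ... | just x  = x ∷ justs (g ∘ suc)

  length-justs : ∀ {k} (g : Fin k → Maybe A) → length (justs g) ≡ countFin (is-just ∘ g)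
  length-justs {zero}  g = refl
  length-justs {suc k} g with g zero
  ... | nothing = length-justs (g ∘ suc)
  ... | just _  = cong suc (length-justs (g ∘ suc))

  nth-justs⁻ : ∀ {k} (g : Fin k → Maybe A) a {x} → nth (justs g) a ≡ just x → ∃[ i ] g i ≡ just x
  nth-justs⁻ {suc k} g a eq with g zero in g₀
  nth-justs⁻ {suc k} g a       eq   | nothing = let i , gᵢ = nth-justs⁻ (g ∘ suc) a eq in suc i , gᵢ
  nth-justs⁻ {suc k} g zero    refl | just _  = zero , g₀
  nth-justs⁻ {suc k} g (suc a) eq   | just _  = let i , gᵢ = nth-justs⁻ (g ∘ suc) a eq in suc i , gᵢ

  nth-justs⁺ : ∀ {k} (g : Fin k → Maybe A) i {x} → g i ≡ just x → ∃[ a ] nth (justs g) a ≡ just x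
  nth-justs⁺ g zero    g₀ rewrite g₀ = zero , refl
  nth-justs⁺ g (suc i) gᵢ with g zero
  ... | nothing = nth-justs⁺ (g ∘ suc) i gᵢ
  ... | just _  = let a , eq = nth-justs⁺ (g ∘ suc) i gᵢ in suc a , eq

  nth-justs-injective : ∀ {k} (g : Fin k → Maybe A) {x} →
    (∀ {i i′} → g i ≡ just x → g i′ ≡ just x → i ≡ i′) →
    ∀ a b → nth (justs g) a ≡ just x → nth (justs g) b ≡ just x → a ≡ b
  nth-justs-injective {suc k} g g-inj a b eqa eqb with g zero in g₀
  ... | nothing = nth-justs-injective (g ∘ suc) (suc-injective ∘₂ g-inj) a b eqa eqb
  nth-justs-injective {suc k} g g-inj zero    zero    eqa  eqb  | just _ = refl
  nth-justs-injective {suc k} g g-inj zero    (suc b) refl eqb  | just _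
    with () ← g-inj g₀ (proj₂ (nth-justs⁻ (g ∘ suc) b eqb))
  nth-justs-injective {suc k} g g-inj (suc a) zero    eqa  refl | just _
    with () ← g-inj g₀ (proj₂ (nth-justs⁻ (g ∘ suc) a eqa))
  nth-justs-injective {suc k} g g-inj (suc a) (suc b) eqa  eqb  | just _ =
    cong suc (nth-justs-injective (g ∘ suc) (suc-injective ∘₂ g-inj) a b eqa eqb)

-- Up to a relation, since functions can only be listed up to pointwise equality.
Exhausts : {A : Set} → (A → A → Set) → List A → Set
Exhausts {A} _≈_ xs = ∀ (x : A) → ∃[ y ] y ∈ xs × y ≈ x

module _ {A : Set} where

  functions : List A → (k : ℕ) → List (Fin k → A)
  functions xs zero    = (λ ()) ∷ []
  functions xs (suc k) = map (λ (x , f) → x Vector.∷ f) (cartesianProduct xs (functions xs k))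

  functions-exhausts : ∀ {_≈_ : A → A → Set} {xs} → Exhausts _≈_ xs →
    ∀ k → Exhausts (Pointwise _≈_) (functions xs k)
  functions-exhausts xs-ex zero    f = (λ ()) , here refl , λ ()
  functions-exhausts xs-ex (suc k) f
    with y , y∈ , y≈ ← xs-ex (f zero) | g , g∈ , g≈ ← functions-exhausts xs-ex k (f ∘ suc) =
    y Vector.∷ g , ∈-map⁺ _ (∈-cartesianProduct⁺ y∈ g∈) , λ { zero → y≈ ; (suc i) → g≈ i }

cartesianProduct-exhausts : ∀ {A B : Set} {_≈₁_ : A → A → Set} {_≈₂_ : B → B → Set} {xs ys} →
  Exhausts _≈₁_ xs → Exhausts _≈₂_ ys → Exhausts (×.Pointwise _≈₁_ _≈₂_) (cartesianProduct xs ys)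
cartesianProduct-exhausts xs-ex ys-ex (a , b)
  with x , x∈ , x≈ ← xs-ex a | y , y∈ , y≈ ← ys-ex b =
  (x , y) , ∈-cartesianProduct⁺ x∈ y∈ , x≈ , y≈

maybeFins : ∀ n → List (Maybe (Fin n))
maybeFins n = nothing ∷ map just (allFin n)

maybeFins-exhausts : ∀ n → Exhausts _≡_ (maybeFins n)
maybeFins-exhausts n nothing  = nothing , here refl , refl
maybeFins-exhausts n (just j) = just j , there (∈-map⁺ just (∈-allFin j)) , refl

bools : List Bool
bools = true ∷ false ∷ []

bools-exhausts : Exhausts _≡_ bools
bools-exhausts true  = true , here refl , refl
bools-exhausts false = false , there (here refl) , refl

ℕ/1≡mkℚ : ∀ a → ℤ.+ a / 1 ≡ mkℚ (ℤ.+ a) 0 (Coprime.sym (Coprime.1-coprimeTo a))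
ℕ/1≡mkℚ a = ℚP.normalize-coprime (Coprime.sym (Coprime.1-coprimeTo a))

ℕ/1-mono-≤ : ∀ {a b} → a ≤ b → ℤ.+ a / 1 ℚ.≤ ℤ.+ b / 1
ℕ/1-mono-≤ {a} {b} a≤b rewrite ℕ/1≡mkℚ a | ℕ/1≡mkℚ b =
  ℚ.*≤* (subst₂ ℤ._≤_ (sym (ℤP.*-identityʳ (ℤ.+ a))) (sym (ℤP.*-identityʳ (ℤ.+ b))) (ℤ.+≤+ a≤b))

module _ (m n : ℕ) (r dl p : Fin n → ℕ) where
  open Instance m n r dl p

  RunsAt : Schedule → Fin n → Slot → Set
  RunsAt S j t = ∃[ k ] S k t ≡ just j

  runsOn-true⇔ : ∀ S j k t → runsOn S j k t ≡ true ⇔ S k t ≡ just j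
  runsOn-true⇔ S j k t with S k t
  ... | nothing = mk⇔ (λ ()) (λ ())
  ... | just j′ with j′ Fin.≟ j
  ...   | yes refl = mk⇔ (λ _ → refl) (λ _ → refl)
  ...   | no j′≢j  = mk⇔ (λ ()) (λ eq → contradiction (MaybeP.just-injective eq) j′≢j)

  assignedAt-true⇔ : ∀ S j t → assignedAt S j t ≡ true ⇔ RunsAt S j t
  assignedAt-true⇔ S j t = ⇔.trans (anyFin-true⇔ (λ k → runsOn S j k t))
    (mk⇔ (λ (k , runs) → k , Equivalence.to (runsOn-true⇔ S j k t) runs)
         (λ (k , Skt) → k , Equivalence.from (runsOn-true⇔ S j k t) Skt))

  countFin-assignedAt-cong : ∀ {S S′} → (∀ j t → RunsAt S j t ⇔ RunsAt S′ j t) →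
    ∀ j → countFin (assignedAt S j) ≡ countFin (assignedAt S′ j)
  countFin-assignedAt-cong {S} {S′} S⇔S′ j = countFin-cong λ t →
    ⇔.trans (assignedAt-true⇔ S j t) (⇔.trans (S⇔S′ j t) (⇔.sym (assignedAt-true⇔ S′ j t)))

  jobsAt : Schedule → Slot → List (Fin n)
  jobsAt S t = justs (λ k → S k t)

  compact : Schedule → Schedule
  compact S k t = nth (jobsAt S t) (toℕ k)

  onCount : States → Slot → ℕ
  onCount on t = countFin (λ k → on k t)

  compactStates : States → States
  compactStates on k t = toℕ k <ᵇ onCount on t

  length-jobsAt≤ : ∀ S t → length (jobsAt S t) ≤ m
  length-jobsAt≤ S t = subst (_≤ m) (sym (length-justs (λ k → S k t))) (countFin≤ _)

  runsAt-compact⇔ : ∀ S j t → RunsAt (compact S) j t ⇔ RunsAt S j t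
  runsAt-compact⇔ S j t = mk⇔ (λ (k , eq) → nth-justs⁻ (λ k → S k t) (toℕ k) eq) from
    where
    from : RunsAt S j t → RunsAt (compact S) j t
    from (k , eq) =
      let a , eq′ = nth-justs⁺ (λ k → S k t) k eq
          a<m = ℕP.<-≤-trans (nth-just⇒< (jobsAt S t) a eq′) (length-jobsAt≤ S t)
      in Fin.fromℕ< a<m , trans (cong (nth (jobsAt S t)) (toℕ-fromℕ< a<m)) eq′

  compact-feasible : ∀ S → Feasible S → Feasible (compact S)
  compact-feasible S F = record
    { volume     = λ j → trans (countFin-assignedAt-cong (runsAt-compact⇔ S) j) (volume j)
    ; window     = λ k t j eq → let k′ , eq′ = nth-justs⁻ (λ k → S k t) (toℕ k) eq in window k′ t j eq′
    ; noParallel = λ k k′ t j eq eq′ → toℕ-injective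
        (nth-justs-injective (λ k → S k t) (noParallel _ _ t j) (toℕ k) (toℕ k′) eq eq′)
    }
    where open Feasible F

  compact-consistent : ∀ S on → Consistent S on → Consistent (compact S) (compactStates on)
  compact-consistent S on C k t busy = Equivalence.to BoolP.T-≡ (ℕP.<⇒<ᵇ (begin-strict
    toℕ k                             <⟨ Equivalence.to (nth-is-just⇔< (jobsAt S t) (toℕ k)) busy ⟩
    length (jobsAt S t)               ≡⟨ length-justs (λ k → S k t) ⟩
    countFin (λ k → is-just (S k t))  ≤⟨ countFin-mono (λ k → C k t) ⟩
    onCount on t                      ∎))
    where open ℕP.≤-Reasoning

  compact-stair : ∀ S → Stair (compact S)
  compact-stair S t k k′ k′≤k busy = Equivalence.from (nth-is-just⇔< (jobsAt S t) (toℕ k′))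
    (ℕP.≤-<-trans k′≤k (Equivalence.to (nth-is-just⇔< (jobsAt S t) (toℕ k)) busy))

  onSlots-compactStates : ∀ on → onSlots (compactStates on) ≡ onSlots on
  onSlots-compactStates on = begin
    onSlots (compactStates on)
      ≡⟨ sumFin-comm (λ k t → if compactStates on k t then 1 else 0) ⟩
    sumFin (onCount (compactStates on))
      ≡⟨ sumFin-cong (λ t → countFin-<ᵇ {m} (onCount on t) (countFin≤ _)) ⟩
    sumFin (onCount on)
      ≡⟨ sumFin-comm (λ k t → if on k t then 1 else 0) ⟨
    onSlots on
      ∎
    where open ≡-Reasoning

  turnOnCount-compactStates : ∀ on t →
    countFin (λ k → turnedOn (compactStates on) k t) ≤ countFin (λ k → turnedOn on k t)
  turnOnCount-compactStates on zero = ℕP.≤-reflexive (countFin-<ᵇ {m} (onCount on zero) (countFin≤ _))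
  turnOnCount-compactStates on (suc t) = begin
    countFin (λ k → turnedOn (compactStates on) k (suc t))
      ≡⟨ countFin-<ᵇ-∸ {m} (onCount on (suc t)) (onCount on (Fin.inject₁ t)) (countFin≤ _) ⟩
    onCount on (suc t) ∸ onCount on (Fin.inject₁ t)
      ≤⟨ countFin-∸-≤ (λ k → on k (suc t)) (λ k → on k (Fin.inject₁ t)) ⟩
    countFin (λ k → turnedOn on k (suc t))
      ∎
    where open ℕP.≤-Reasoning

  switchOns-compactStates : ∀ on → switchOns (compactStates on) ≤ switchOns on
  switchOns-compactStates on = begin
    switchOns (compactStates on)
      ≡⟨ sumFin-comm (λ k t → if turnedOn (compactStates on) k t then 1 else 0) ⟩
    sumFin (λ t → countFin (λ k → turnedOn (compactStates on) k t))
      ≤⟨ sumFin-mono-≤ (turnOnCount-compactStates on) ⟩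
    sumFin (λ t → countFin (λ k → turnedOn on k t))
      ≡⟨ sumFin-comm (λ k t → if turnedOn on k t then 1 else 0) ⟨
    switchOns on
      ∎
    where open ℕP.≤-Reasoning

  energy-compactStates : ∀ q → 0ℚ ℚ.≤ q → ∀ on → energy q (compactStates on) ℚ.≤ energy q on
  energy-compactStates q 0≤q on rewrite onSlots-compactStates on =
    ℚP.+-monoʳ-≤ (ℤ.+ onSlots on / 1)
      (ℚP.*-monoˡ-≤-nonNeg q {{ℚ.nonNegative 0≤q}} (ℕ/1-mono-≤ (switchOns-compactStates on)))

  _≗₂_ : ∀ {X : Set} → (Fin m → Slot → X) → (Fin m → Slot → X) → Set
  _≗₂_ = Pointwise (Pointwise _≡_)

  feasible-resp : ∀ {S S′} → S ≗₂ S′ → Feasible S → Feasible S′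
  feasible-resp {S} {S′} S≗S′ F = record
    { volume     = λ j → trans (countFin-assignedAt-cong runsAt⇔ j) (volume j)
    ; window     = λ k t j eq → window k t j (trans (S≗S′ k t) eq)
    ; noParallel = λ k k′ t j eq eq′ →
        noParallel k k′ t j (trans (S≗S′ k t) eq) (trans (S≗S′ k′ t) eq′)
    }
    where
    open Feasible F
    runsAt⇔ : ∀ j t → RunsAt S′ j t ⇔ RunsAt S j t
    runsAt⇔ j t = mk⇔ (λ (k , eq) → k , trans (S≗S′ k t) eq)
                      (λ (k , eq) → k , trans (sym (S≗S′ k t)) eq)

  consistent-resp : ∀ {S S′ on on′} → S ≗₂ S′ → on ≗₂ on′ → Consistent S on → Consistent S′ on′
  consistent-resp S≗S′ on≗on′ C k t busy =
    trans (sym (on≗on′ k t)) (C k t (trans (cong is-just (S≗S′ k t)) busy))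

  energy-resp : ∀ q {on on′} → on ≗₂ on′ → energy q on ≡ energy q on′
  energy-resp q {on} {on′} on≗on′ = cong₂ (λ a b → ℤ.+ a / 1 ℚ.+ q ℚ.* (ℤ.+ b / 1))
    (sumFin-cong λ k → sumFin-cong λ t → cong (if_then 1 else 0) (on≗on′ k t))
    (sumFin-cong λ k → sumFin-cong λ t → cong (if_then 1 else 0) (turnedOn-resp k t))
    where
    turnedOn-resp : turnedOn on ≗₂ turnedOn on′
    turnedOn-resp k zero    = on≗on′ k zero
    turnedOn-resp k (suc t) = cong₂ (λ a b → a ∧ not b) (on≗on′ k (suc t)) (on≗on′ k (Fin.inject₁ t))

  feasible? : ∀ S → Dec (Feasible S)
  feasible? S = map′ (λ (v , w , np) → record { volume = v ; window = w ; noParallel = np })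
    (λ F → Feasible.volume F , Feasible.window F , Feasible.noParallel F)
    (all? (λ j → countFin (assignedAt S j) ℕP.≟ p j)
     ×-dec (all? λ k → all? λ t → all? λ j →
              S k t ≟just j →-dec ((r j ℕP.≤? toℕ t) ×-dec (toℕ t ℕP.≤? dl j)))
     ×-dec (all? λ k → all? λ k′ → all? λ t → all? λ j →
              S k t ≟just j →-dec (S k′ t ≟just j →-dec (k Fin.≟ k′))))
    where
    _≟just_ : ∀ (x : Maybe (Fin n)) j → Dec (x ≡ just j)
    x ≟just j = MaybeP.≡-dec Fin._≟_ x (just j)

  consistent? : ∀ S on → Dec (Consistent S on)
  consistent? S on = all? λ k → all? λ t → (is-just (S k t) BoolP.≟ true) →-dec (on k t BoolP.≟ true)

  Admissible : Schedule × States → Set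
  Admissible (S , on) = Feasible S × Consistent S on

  admissible? : ∀ x → Dec (Admissible x)
  admissible? (S , on) = feasible? S ×-dec consistent? S on

  candidates : List (Schedule × States)
  candidates = cartesianProduct (functions (functions (maybeFins n) (suc horizon)) m)
                                (functions (functions bools (suc horizon)) m)

  candidates-exhaust : Exhausts (×.Pointwise _≗₂_ _≗₂_) candidates
  candidates-exhaust = cartesianProduct-exhausts
    (functions-exhausts (functions-exhausts (maybeFins-exhausts n) (suc horizon)) m)
    (functions-exhausts (functions-exhausts bools-exhausts (suc horizon)) m)

  optimal-exists : ∀ q → Σ Schedule Feasible → Σ Schedule λ S → Σ States λ on → Optimal q S on
  optimal-exists q (S₀ , F₀) =
    proj₁ best , proj₂ best , proj₁ best-admissible , proj₂ best-admissible , best-minimal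
    where
    open Data.List.Extrema (DecTotalOrder.totalOrder ℚP.≤-decTotalOrder)
    admissibles : List (Schedule × States)
    admissibles = filter admissible? candidates
    cost : Schedule × States → ℚ
    cost = energy q ∘ proj₂
    fallback : Schedule × States
    fallback = S₀ , λ k t → is-just (S₀ k t)
    best : Schedule × States
    best = argmin cost fallback admissibles
    best-admissible : Admissible best
    best-admissible = argmin-all cost (F₀ , λ k t busy → busy) (all-filter admissible? candidates)
    best-minimal : ∀ S on → Feasible S → Consistent S on → cost best ℚ.≤ energy q on
    best-minimal S on F C =
      let (S′ , on′) , x∈ , S′≗S , on′≗on = candidates-exhaust (S , on)
          x-admissible = feasible-resp (λ k t → sym (S′≗S k t)) F ,
                         consistent-resp (λ k t → sym (S′≗S k t)) (λ k t → sym (on′≗on k t)) C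
      in ℚP.≤-trans
           (All.lookup (f[argmin]≤f[xs] {f = cost} fallback admissibles) (∈-filter⁺ admissible? x∈ x-admissible))
           (ℚP.≤-reflexive (energy-resp q on′≗on))

  optimal-compact : ∀ q → 0ℚ ℚ.≤ q → ∀ {S on} → Optimal q S on → Optimal q (compact S) (compactStates on)
  optimal-compact q 0≤q {S} {on} (F , C , minimal) =
    compact-feasible S F , compact-consistent S on C ,
    λ S′ on′ F′ C′ → ℚP.≤-trans (energy-compactStates q 0≤q on) (minimal S′ on′ F′ C′)

lemma1 : (m n : ℕ) (r dl p : Fin n → ℕ) (q : ℚ) →
    1 ≤ m →
    0ℚ Data.Rational.≤ q →
    (n ≡ 0 ⊎ Σ (Fin n) (λ j → r j ≡ 0)) →
    let open Instance m n r dl p in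
    Σ Schedule Feasible →
    Σ Schedule (λ S → Σ States (λ on → Optimal q S on × Stair S))
lemma1 m n r dl p q _ 0≤q _ feasible =
  let S , on , optimal = optimal-exists m n r dl p q feasible
  in compact m n r dl p S , compactStates m n r dl p on ,
     optimal-compact m n r dl p q 0≤q optimal , compact-stair m n r dl p S
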